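{- Let $H$ be a graph with vertex set $A\cup\{v\}$, where $v\notin A$, $A$ is a clique, and $v$ has a neighbour and a non-neighbour in $A$. Let $F$ be a spanning subgraph of $H$ obtained by removing some edges incident to $v$. Then $H\xrightarrow{\cap}F$.
   Context: All graphs are finite and simple. For graphs $G_1=(V_1,E_1)$, $G_2=(V_2,E_2)$, $G_1\cap G_2=(V_1\cap V_2,E_1\cap E_2)$. For $G=(V,E)$ and an injective map $\alpha$ on $V$, $G^{\alpha}$ has vertex set $\alpha(V)$ and edge set $\{\{\alpha(v),\alpha(w)\}:\{v,w\}\in E\}$. We write $G\xrightarrow{\cap}H$ if $H=G^{\alpha_1}\cap\cdots\cap G^{\alpha_k}$ for some injective maps $\alpha_1,\dots,\alpha_k$ on $V(G)$ (up to isomorphism of $H$). -}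

module Defs where

open import Data.Nat using (ℕ)
open import Data.Fin using (Fin)
open import Data.Bool using (Bool; true; false)
open import Data.Product using (Σ; ∃; ∃-syntax; _×_; _,_)
open import Relation.Binary.PropositionalEquality using (_≡_; _≢_)
open import Relation.Nullary using (¬_)
open import Function.Definitions using (Injective)
open import Function.Bundles using (_⇔_)

record Graph (n : ℕ) : Set where
  field
    adj   : Fin n → Fin n → Bool
    sym   : ∀ x y → adj x y ≡ adj y x
    irrefl : ∀ x → adj x x ≡ false
open Graph public

Adj : ∀ {n} → Graph n → Fin n → Fin n → Set
Adj G x y = adj G x y ≡ true

-- Injective maps on V(G), with values in a common label set ℕ.
-- Vertex set of G^{α_1} ∩ ... ∩ G^{α_k}: labels in every image α_i(V).
InterVertex : ∀ {n k} → (Fin k → Fin n → ℕ) → ℕ → Set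
InterVertex {n} α u = ∀ i → ∃[ x ] α i x ≡ u

InterEdge : ∀ {n k} → Graph n → (Fin k → Fin n → ℕ) → ℕ → ℕ → Set
InterEdge {n} G α u w = ∀ i → ∃[ x ] ∃[ y ] (α i x ≡ u × α i y ≡ w × Adj G x y)

IsoTo : ∀ {m} → Graph m → (ℕ → Set) → (ℕ → ℕ → Set) → Set
IsoTo {m} H P E =
  Σ (Fin m → ℕ) λ f →
    Injective _≡_ _≡_ f
    × (∀ a → P (f a))
    × (∀ u → P u → ∃[ a ] f a ≡ u)
    × (∀ a b → Adj H a b ⇔ E (f a) (f b))

-- G →∩ H : H ≅ G^{α_1} ∩ ... ∩ G^{α_k} for some injective α_1,…,α_k on V(G).
_→∩_ : ∀ {n m} → Graph n → Graph m → Set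
_→∩_ {n} {m} G H =
  ∃[ k ] Σ (Fin k → Fin n → ℕ) λ α →
    (∀ i → Injective _≡_ _≡_ (α i))
    × IsoTo H (InterVertex α) (InterEdge G α)

-- Keep the identity relabelling, and for every vertex i outside v whose edge
-- to v is missing in F add the relabelling swapping i with a fixed
-- non-neighbour c of v.  A swap of two vertices of the clique A fixes v, maps
-- A onto A and every F-neighbour of v to itself (such a neighbour is neither
-- i nor c), so it maps every edge of F into H; but it moves the edge vi onto
-- the non-edge vc.  Hence the intersection of these copies of H is exactly F.
module Submission where

open import Defs
open import Data.Nat using (ℕ)
open import Data.Fin using (Fin; toℕ)
open import Data.Fin.Properties using (_≟_; toℕ-injective)
open import Data.Fin.Permutation using (Permutation′; _⟨$⟩ʳ_; _⟨$⟩ˡ_; inverseˡ; inverseʳ; id; transpose)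
import Data.Fin.Permutation.Components as PC
open import Data.Bool using (true)
import Data.Bool.Properties as Bool
open import Data.Empty using (⊥-elim)
open import Data.Product using (∃-syntax; _×_; _,_)
open import Function.Bundles using (_⇔_; mk⇔; Injection; module Equivalence)
open import Function.Definitions using (Injective)
open import Function.Properties.Inverse using (↔⇒↣)
open import Relation.Binary.Definitions using (Decidable)
open import Relation.Binary.PropositionalEquality
  using (_≡_; _≢_; refl; cong; subst₂) renaming (sym to ≡-sym; trans to ≡-trans)
open import Relation.Nullary using (¬_; yes; no)
open import Relation.Nullary.Decidable using (dec-true; dec-false)

module _ {n : ℕ} (G : Graph n) where

  Adj? : Decidable (Adj G)
  Adj? x y = adj G x y Bool.≟ true

  Adj-sym : ∀ {x y} → Adj G x y → Adj G y x
  Adj-sym {x} {y} xy = ≡-trans (Graph.sym G y x) xy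

  Adj-irrefl : ∀ {x y} → Adj G x y → x ≢ y
  Adj-irrefl {x} xx refl with ≡-trans (≡-sym xx) (irrefl G x)
  ... | ()

module _ {n : ℕ} (i j : Fin n) where

  transpose-matchˡ : PC.transpose i j i ≡ j
  transpose-matchˡ rewrite dec-true (i ≟ i) refl = refl

  transpose-fix : ∀ {k} → k ≢ i → k ≢ j → PC.transpose i j k ≡ k
  transpose-fix {k} k≢i k≢j rewrite dec-false (k ≟ i) k≢i | dec-false (k ≟ j) k≢j = refl

  transpose-injective : ∀ {k l} → PC.transpose i j k ≡ PC.transpose i j l → k ≡ l
  transpose-injective {k} {l} eq =
    ≡-trans (≡-sym (PC.transpose-inverse j i)) (≡-trans (cong (PC.transpose j i) eq) (PC.transpose-inverse j i))

module _ {n k : ℕ} (G F : Graph n) (π : Fin k → Permutation′ n) where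

  relabel : Fin k → Fin n → ℕ
  relabel i x = toℕ (π i ⟨$⟩ʳ x)

  relabel-injective : ∀ i → Injective _≡_ _≡_ (relabel i)
  relabel-injective i eq = Injection.injective (↔⇒↣ (π i)) (toℕ-injective eq)

  preimage-unique : ∀ i {x a} → relabel i x ≡ toℕ a → x ≡ π i ⟨$⟩ˡ a
  preimage-unique i {x} eq = ≡-trans (≡-sym (inverseˡ (π i))) (cong (π i ⟨$⟩ˡ_) (toℕ-injective eq))

  relabelled-edge : ∀ {a b} →
    (∀ i → Adj G (π i ⟨$⟩ˡ a) (π i ⟨$⟩ˡ b)) ⇔ InterEdge G relabel (toℕ a) (toℕ b)
  relabelled-edge {a} {b} = mk⇔
    (λ ab i → π i ⟨$⟩ˡ a , π i ⟨$⟩ˡ b , cong toℕ (inverseʳ (π i)) , cong toℕ (inverseʳ (π i)) , ab i)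
    (λ { ab i → let (x , y , xa , yb , xy) = ab i in
           subst₂ (Adj G) (preimage-unique i xa) (preimage-unique i yb) xy })

  →∩-by-permutations : Fin k →
    (∀ a b → Adj F a b ⇔ (∀ i → Adj G (π i ⟨$⟩ˡ a) (π i ⟨$⟩ˡ b))) → G →∩ F
  →∩-by-permutations i₀ F⇔ =
    k , relabel , relabel-injective
      , toℕ , toℕ-injective
      , (λ a i → π i ⟨$⟩ˡ a , cong toℕ (inverseʳ (π i)))
      , (λ u u∈ → let (x , xu) = u∈ i₀ in π i₀ ⟨$⟩ʳ x , xu)
      , λ a b → mk⇔ (λ ab → Equivalence.to relabelled-edge (Equivalence.to (F⇔ a b) ab))
                     (λ ab → Equivalence.from (F⇔ a b) (Equivalence.from relabelled-edge ab))

module SpokeRemoval {m : ℕ} (H F : Graph m) (v c : Fin m)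
  (clique : ∀ a b → a ≢ v → b ≢ v → a ≢ b → Adj H a b)
  (c≢v : c ≢ v) (v≁c : ¬ Adj H v c)
  (F⊆H : ∀ a b → Adj F a b → Adj H a b)
  (H⊆F : ∀ a b → a ≢ v → b ≢ v → Adj H a b → Adj F a b) where

  module _ {i : Fin m} (i≢v : i ≢ v) (v≁i : ¬ Adj F v i) where

    swap-fixes-v : PC.transpose i c v ≡ v
    swap-fixes-v = transpose-fix i c (λ v≡i → i≢v (≡-sym v≡i)) (λ v≡c → c≢v (≡-sym v≡c))

    swap-fixes-neighbour : ∀ {b} → Adj F v b → PC.transpose i c b ≡ b
    swap-fixes-neighbour {b} vb = transpose-fix i c (λ { refl → v≁i vb }) (λ { refl → v≁c (F⊆H v b vb) })

    swap-avoids-v : ∀ {x} → x ≢ v → PC.transpose i c x ≢ v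
    swap-avoids-v x≢v τx≡v = x≢v (transpose-injective i c (≡-trans τx≡v (≡-sym swap-fixes-v)))

    swap-spoke : ∀ {b} → Adj F v b → Adj H (PC.transpose i c v) (PC.transpose i c b)
    swap-spoke {b} vb = subst₂ (Adj H) (≡-sym swap-fixes-v) (≡-sym (swap-fixes-neighbour vb)) (F⊆H v b vb)

    swap-preserves : ∀ a b → Adj F a b → Adj H (PC.transpose i c a) (PC.transpose i c b)
    swap-preserves a b ab with a ≟ v | b ≟ v
    ... | yes refl | _        = swap-spoke ab
    ... | no _     | yes refl = Adj-sym H (swap-spoke (Adj-sym F ab))
    ... | no a≢v   | no b≢v   = clique _ _ (swap-avoids-v a≢v) (swap-avoids-v b≢v)
                                  (λ eq → Adj-irrefl F ab (transpose-injective i c eq))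

  relabelling : Fin m → Permutation′ m
  relabelling i with i ≟ v | Adj? F v i
  ... | no _ | no _ = transpose c i
  ... | _    | _    = id

  relabelling-preserves : ∀ i a b → Adj F a b → Adj H (relabelling i ⟨$⟩ˡ a) (relabelling i ⟨$⟩ˡ b)
  relabelling-preserves i a b ab with i ≟ v | Adj? F v i
  ... | no i≢v | no v≁i = swap-preserves i≢v v≁i a b ab
  ... | yes _  | _      = F⊆H a b ab
  ... | no _   | yes _  = F⊆H a b ab

  relabelling-v : ∀ x → relabelling v ⟨$⟩ˡ x ≡ x
  relabelling-v x with v ≟ v | Adj? F v v
  ... | yes _  | _ = refl
  ... | no v≢v | _ = ⊥-elim (v≢v refl)

  relabelling-non-neighbour : ∀ {b} → b ≢ v → ¬ Adj F v b → ∀ x → relabelling b ⟨$⟩ˡ x ≡ PC.transpose b c x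
  relabelling-non-neighbour {b} b≢v v≁b x with b ≟ v | Adj? F v b
  ... | no _   | no _  = refl
  ... | yes b≡v | _    = ⊥-elim (b≢v b≡v)
  ... | no _   | yes vb = ⊥-elim (v≁b vb)

  EdgeOfEveryCopy : Fin m → Fin m → Set
  EdgeOfEveryCopy a b = ∀ i → Adj H (relabelling i ⟨$⟩ˡ a) (relabelling i ⟨$⟩ˡ b)

  edge-of-H : ∀ {a b} → EdgeOfEveryCopy a b → Adj H a b
  edge-of-H ab = subst₂ (Adj H) (relabelling-v _) (relabelling-v _) (ab v)

  -- The copy indexed by b carries vb onto the non-edge vc.
  spoke-of-F : ∀ {b} → EdgeOfEveryCopy v b → Adj F v b
  spoke-of-F {b} vb with Adj? F v b
  ... | yes v~b = v~b
  ... | no v≁b  = ⊥-elim (v≁c (subst₂ (Adj H) v↦v b↦c (vb b)))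
    where
      b≢v : b ≢ v
      b≢v b≡v = Adj-irrefl H (edge-of-H vb) (≡-sym b≡v)
      v↦v : relabelling b ⟨$⟩ˡ v ≡ v
      v↦v = ≡-trans (relabelling-non-neighbour b≢v v≁b v) (swap-fixes-v b≢v v≁b)
      b↦c : relabelling b ⟨$⟩ˡ b ≡ c
      b↦c = ≡-trans (relabelling-non-neighbour b≢v v≁b b) (transpose-matchˡ b c)

  edge-of-F : ∀ a b → EdgeOfEveryCopy a b → Adj F a b
  edge-of-F a b ab with a ≟ v | b ≟ v
  ... | yes refl | _        = spoke-of-F ab
  ... | no _     | yes refl = Adj-sym F (spoke-of-F (λ i → Adj-sym H (ab i)))
  ... | no a≢v   | no b≢v   = H⊆F a b a≢v b≢v (edge-of-H ab)

  H→∩F : H →∩ F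
  H→∩F = →∩-by-permutations H F relabelling v
    (λ a b → mk⇔ (λ ab i → relabelling-preserves i a b ab) (edge-of-F a b))

lemma11 : ∀ {m} (H F : Graph m) (v : Fin m) →
    (∀ a b → a ≢ v → b ≢ v → a ≢ b → Adj H a b) →
    (∃[ a ] (a ≢ v × Adj H v a)) →
    (∃[ a ] (a ≢ v × ¬ Adj H v a)) →
    (∀ a b → Adj F a b → Adj H a b) →
    (∀ a b → a ≢ v → b ≢ v → Adj H a b → Adj F a b) →
    H →∩ F
lemma11 H F v clique _ (c , c≢v , v≁c) F⊆H H⊆F = SpokeRemoval.H→∩F H F v c clique c≢v v≁c F⊆H H⊆F
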